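{- For each $p\in\Omega$ there is a primitive modified ascent sequence $x$ such that $\mathfrak{st}(x)=p$.
   Context: A Cayley permutation of length $n$ is a word $x=x_1\cdots x_n$ of positive integers whose set of values is $\{1,\dots,k\}$ for some $k\le n$. The ascent tops of $x$ are the pairs $(1,x_1)$ and $(i,x_i)$ with $1<i\le n$ and $x_{i-1}<x_i$; the leftmost copies of $x$ are the pairs $(\min\{i:x_i=j\},j)$ for $1\le j\le\max(x)$. A modified ascent sequence is a Cayley permutation whose set of ascent tops equals its set of leftmost copies; it is primitive if it has no two consecutive equal entries. Standardization: if $a_i$ is the number of entries of $x$ equal to $i$, then $\mathfrak{st}(x)$ is the permutation obtained by replacing the $a_i$ copies of $i$, from left to right, by $a_1+\cdots+a_{i-1}+1,\dots,a_1+\cdots+a_{i-1}+a_i$. $\Omega$ is the set of permutations $p=p_1\cdots p_n$ (of any length $n\ge0$) such that either $n=0$ or $p_1=1$, and such that there are no indices $i,j$ with $i+1<j$, $p_i>p_{i+1}$ and $p_{i+1}=p_j+1$. -}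

module Defs where

open import Data.Nat using (ℕ; zero; suc; _+_; _<_; _≤_)
open import Data.List using (List; []; _∷_; length; map; upTo; _++_; [_])
open import Data.List.Relation.Binary.Permutation.Propositional using (_↭_)
open import Data.Maybe using (Maybe; just; nothing)
open import Data.Product using (_×_; Σ; ∃; ∃-syntax)
open import Data.Sum using (_⊎_)
open import Data.Bool using (if_then_else_)
open import Relation.Binary.PropositionalEquality using (_≡_)
open import Relation.Nullary using (¬_)
open import Relation.Nullary.Decidable using (⌊_⌋)
open import Function.Bundles using (_⇔_)
import Data.Nat as N

-- Words are lists of natural numbers; positions are 0-indexed
-- (position i here is position i+1 in the paper).
_‼_ : List ℕ → ℕ → Maybe ℕ
[] ‼ _ = nothing
(a ∷ _) ‼ zero = just a
(_ ∷ as) ‼ suc i = as ‼ i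

IsCayley : List ℕ → Set
IsCayley x = (∀ i v → x ‼ i ≡ just v → 1 ≤ v)
           × Σ ℕ λ k → ∀ v → (1 ≤ v × v ≤ k) ⇔ (∃[ i ] x ‼ i ≡ just v)

AscentTop : List ℕ → ℕ → ℕ → Set
AscentTop x zero v = x ‼ zero ≡ just v
AscentTop x (suc i) v = x ‼ suc i ≡ just v × Σ ℕ λ u → x ‼ i ≡ just u × u < v

-- (i , v) is a leftmost copy of x: i = min {i : x_i = v}
-- (for a Cayley permutation, v ranges over 1..max x exactly when v occurs)
LeftmostCopy : List ℕ → ℕ → ℕ → Set
LeftmostCopy x i v = x ‼ i ≡ just v × (∀ k → k < i → ¬ (x ‼ k ≡ just v))

IsModAscent : List ℕ → Set
IsModAscent x = IsCayley x × (∀ i v → AscentTop x i v ⇔ LeftmostCopy x i v)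

IsPrimitive : List ℕ → Set
IsPrimitive x = ∀ i u v → x ‼ i ≡ just u → x ‼ suc i ≡ just v → ¬ (u ≡ v)

IsPrimitiveModAscent : List ℕ → Set
IsPrimitiveModAscent x = IsModAscent x × IsPrimitive x

countLess : ℕ → List ℕ → ℕ
countLess a [] = 0
countLess a (b ∷ bs) = (if ⌊ b N.<? a ⌋ then 1 else 0) + countLess a bs

countEq : ℕ → List ℕ → ℕ
countEq a [] = 0
countEq a (b ∷ bs) = (if ⌊ b N.≟ a ⌋ then 1 else 0) + countEq a bs

-- Standardization: the entry x_i (the r-th copy of value a, from the left)
-- becomes a_1 + … + a_{a-1} + r, i.e. #{j : x_j < a} + #{j < i : x_j = a} + 1.
stGo : List ℕ → List ℕ → List ℕ → List ℕ
stGo whole pre [] = []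
stGo whole pre (a ∷ rest) =
  suc (countLess a whole + countEq a pre) ∷ stGo whole (pre ++ [ a ]) rest

st : List ℕ → List ℕ
st x = stGo x [] x

IsPerm : List ℕ → Set
IsPerm p = p ↭ map suc (upTo (length p))

InΩ : List ℕ → Set
InΩ p = IsPerm p
      × (p ≡ [] ⊎ p ‼ 0 ≡ just 1)
      × (∀ i j a b c → suc i < j → p ‼ i ≡ just a → p ‼ suc i ≡ just b
           → p ‼ j ≡ just c → ¬ (a > b × b ≡ c + 1))
  where open N using (_>_)

-- Let T be the set of values of p that are ascent tops, and let rank v be the
-- number of elements of T in {1,…,v}; the witness is x = map rank p, which merges
-- every value v ∉ T with v - 1.  The pattern forbidden in Ω says exactly that such
-- a v, sitting right after a descent, has v - 1 somewhere to its left.  Hence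
-- whenever p_i > p_j with i < j, some t ∈ T lies in (p_j, p_i], so rank keeps the
-- strict order of every inversion: ties in x occur only between increasing pairs,
-- which is what makes st x = p.  The same fact shows that the ascent tops of x sit
-- exactly at the ascent tops of p, and that these are the leftmost copies of x.
module Submission where

open import Defs
open import Data.Bool using (if_then_else_)
open import Data.Empty using (⊥-elim)
open import Data.List using (List; []; _∷_; length; map; upTo; applyUpTo; _++_; [_])
open import Data.List.Membership.Propositional using (_∈_)
open import Data.List.Properties using (map-++; ++-assoc; map-upTo)
open import Data.List.Relation.Binary.Permutation.Propositional using (_↭_)
open import Data.List.Relation.Binary.Permutation.Propositional.Properties using (map⁺)
open import Data.List.Relation.Unary.Any using (here; there)
open import Data.Maybe using (just)
open import Data.Maybe.Properties using (just-injective)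
open import Data.Nat using (ℕ; zero; suc; _+_; _∸_; _≤_; _<_; z≤n; s≤s; _≟_; _<?_; _≤?_)
open import Data.List.Membership.DecPropositional _≟_ using (_∈?_)
open import Data.Nat.ListAction using (sum)
open import Data.Nat.ListAction.Properties using (sum-++; sum-↭)
open import Data.Nat.Properties
open import Algebra.Properties.CommutativeSemigroup +-commutativeSemigroup
  using (interchange; xy∙z≈xz∙y)
open import Data.Product using (Σ; _×_; _,_; proj₁; proj₂; ∃-syntax)
open import Data.Sum using (inj₁; inj₂)
open import Function.Bundles using (_⇔_; mk⇔; Equivalence)
open import Relation.Binary.Definitions using (tri<; tri≈; tri>)
open import Relation.Binary.PropositionalEquality
  using (_≡_; refl; sym; trans; cong; cong₂; subst; module ≡-Reasoning)
open import Relation.Nullary using (¬_; yes; no)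
open import Relation.Nullary.Decidable using (⌊_⌋)
open import Relation.Unary using (Decidable)

open Equivalence using (to; from)

countEq-sum : ∀ v xs → countEq v xs ≡ sum (map (λ b → if ⌊ b ≟ v ⌋ then 1 else 0) xs)
countEq-sum v [] = refl
countEq-sum v (b ∷ xs) = cong (_ +_) (countEq-sum v xs)

countLess-sum : ∀ v xs → countLess v xs ≡ sum (map (λ b → if ⌊ b <? v ⌋ then 1 else 0) xs)
countLess-sum v [] = refl
countLess-sum v (b ∷ xs) = cong (_ +_) (countLess-sum v xs)

countEq-↭ : ∀ v {xs ys} → xs ↭ ys → countEq v xs ≡ countEq v ys
countEq-↭ v {xs} {ys} xs↭ys = begin
  countEq v xs                 ≡⟨ countEq-sum v xs ⟩
  sum (map _ xs)               ≡⟨ sum-↭ (map⁺ _ xs↭ys) ⟩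
  sum (map _ ys)               ≡⟨ countEq-sum v ys ⟨
  countEq v ys                 ∎
  where open ≡-Reasoning

countLess-↭ : ∀ v {xs ys} → xs ↭ ys → countLess v xs ≡ countLess v ys
countLess-↭ v {xs} {ys} xs↭ys = begin
  countLess v xs               ≡⟨ countLess-sum v xs ⟩
  sum (map _ xs)               ≡⟨ sum-↭ (map⁺ _ xs↭ys) ⟩
  sum (map _ ys)               ≡⟨ countLess-sum v ys ⟨
  countLess v ys               ∎
  where open ≡-Reasoning

countLess-++ : ∀ v xs ys → countLess v (xs ++ ys) ≡ countLess v xs + countLess v ys
countLess-++ v xs ys = begin
  countLess v (xs ++ ys)                   ≡⟨ countLess-sum v (xs ++ ys) ⟩
  sum (map _ (xs ++ ys))                   ≡⟨ cong sum (map-++ _ xs ys) ⟩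
  sum (map _ xs ++ map _ ys)               ≡⟨ sum-++ (map _ xs) (map _ ys) ⟩
  sum (map _ xs) + sum (map _ ys)          ≡⟨ cong₂ _+_ (countLess-sum v xs) (countLess-sum v ys) ⟨
  countLess v xs + countLess v ys          ∎
  where open ≡-Reasoning

countLess-++-∷ : ∀ v xs ys → countLess v (xs ++ v ∷ ys) ≡ countLess v xs + countLess v ys
countLess-++-∷ v xs ys = trans (countLess-++ v xs (v ∷ ys)) (cong (countLess v xs +_) skip-v)
  where
  skip-v : countLess v (v ∷ ys) ≡ countLess v ys
  skip-v with v <? v
  ... | yes v<v = ⊥-elim (<-irrefl refl v<v)
  ... | no _ = refl

countLess-suc : ∀ v xs → countLess (suc v) xs ≡ countLess v xs + countEq v xs
countLess-suc v [] = refl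
countLess-suc v (b ∷ xs) =
  trans (cong₂ _+_ indicator (countLess-suc v xs))
        (interchange (if ⌊ b <? v ⌋ then 1 else 0) (if ⌊ b ≟ v ⌋ then 1 else 0)
                     (countLess v xs) (countEq v xs))
  where
  indicator : (if ⌊ b <? suc v ⌋ then 1 else 0)
            ≡ (if ⌊ b <? v ⌋ then 1 else 0) + (if ⌊ b ≟ v ⌋ then 1 else 0)
  indicator with b <? suc v | b <? v | b ≟ v
  ... | yes _     | yes _   | no _    = refl
  ... | yes _     | no _    | yes _   = refl
  ... | no _      | no _    | no _    = refl
  ... | _         | yes b<v | yes b≡v = ⊥-elim (<-irrefl b≡v b<v)
  ... | yes b≤v   | no b≮v  | no b≢v  = ⊥-elim (b≢v (≤∧≮⇒≡ (≤-pred b≤v) b≮v))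
  ... | no b≰v    | yes b<v | _       = ⊥-elim (b≰v (m<n⇒m<1+n b<v))
  ... | no b≰v    | _       | yes refl = ⊥-elim (b≰v ≤-refl)

countLess-map : ∀ (f : ℕ → ℕ) {z a} xs → (∀ {b} → b ∈ xs → f b < z ⇔ b < a) →
                countLess z (map f xs) ≡ countLess a xs
countLess-map f [] _ = refl
countLess-map f {z} {a} (b ∷ xs) agree =
  cong₂ _+_ indicator (countLess-map f xs (λ b∈xs → agree (there b∈xs)))
  where
  indicator : (if ⌊ f b <? z ⌋ then 1 else 0) ≡ (if ⌊ b <? a ⌋ then 1 else 0)
  indicator with f b <? z | b <? a
  ... | yes _   | yes _   = refl
  ... | no _    | no _    = refl
  ... | yes fb<z | no b≮a = ⊥-elim (b≮a (to (agree (here refl)) fb<z))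
  ... | no fb≮z | yes b<a = ⊥-elim (fb≮z (from (agree (here refl)) b<a))

interval : ℕ → ℕ → List ℕ
interval m zero = []
interval m (suc k) = m ∷ interval (suc m) k

applyUpTo≡interval : ∀ {h : ℕ → ℕ} m k → (∀ i → h i ≡ m + i) → applyUpTo h k ≡ interval m k
applyUpTo≡interval m zero _ = refl
applyUpTo≡interval m (suc k) h≗m+ =
  cong₂ _∷_ (trans (h≗m+ 0) (+-identityʳ m))
            (applyUpTo≡interval (suc m) k (λ i → trans (h≗m+ (suc i)) (+-suc m i)))

map-suc-upTo : ∀ n → map suc (upTo n) ≡ interval 1 n
map-suc-upTo n = trans (map-upTo suc n) (applyUpTo≡interval 1 n (λ _ → refl))

countEq-interval-< : ∀ {v} m k → v < m → countEq v (interval m k) ≡ 0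
countEq-interval-< m zero _ = refl
countEq-interval-< {v} m (suc k) v<m with m ≟ v
... | yes refl = ⊥-elim (<-irrefl refl v<m)
... | no _ = countEq-interval-< (suc m) k (m<n⇒m<1+n v<m)

countEq-interval-≤1 : ∀ v m k → countEq v (interval m k) ≤ 1
countEq-interval-≤1 v m zero = z≤n
countEq-interval-≤1 v m (suc k) with m ≟ v
... | yes refl = ≤-reflexive (cong suc (countEq-interval-< (suc m) k ≤-refl))
... | no _ = countEq-interval-≤1 v (suc m) k

0<countEq-interval⇒ : ∀ {v} m k → 0 < countEq v (interval m k) → m ≤ v × v < m + k
0<countEq-interval⇒ {v} m (suc k) pos with m ≟ v
... | yes refl = ≤-refl , m<m+n m (s≤s z≤n)
... | no _ with 0<countEq-interval⇒ (suc m) k pos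
...   | m<v , v<m+k = <⇒≤ m<v , subst (v <_) (sym (+-suc m k)) v<m+k

⇒0<countEq-interval : ∀ {v} m k → m ≤ v → v < m + k → 0 < countEq v (interval m k)
⇒0<countEq-interval {v} m zero m≤v v<m+0 =
  ⊥-elim (<⇒≱ (subst (v <_) (+-identityʳ m) v<m+0) m≤v)
⇒0<countEq-interval {v} m (suc k) m≤v v<m+k with m ≟ v
... | yes _ = s≤s z≤n
... | no m≢v = ⇒0<countEq-interval (suc m) k (≤∧≢⇒< m≤v m≢v) (subst (v <_) (+-suc m k) v<m+k)

countLess-interval : ∀ {v} m k → v ≤ m + k → countLess v (interval m k) ≡ v ∸ m
countLess-interval {v} m zero v≤m+0 = sym (m≤n⇒m∸n≡0 (subst (v ≤_) (+-identityʳ m) v≤m+0))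
countLess-interval {v} m (suc k) v≤m+k
  with m <? v | countLess-interval (suc m) k (subst (v ≤_) (+-suc m k) v≤m+k)
... | yes m<v | ih = trans (cong suc ih) (sym (+-∸-assoc 1 m<v))
... | no m≮v  | ih =
  trans ih (trans (m≤n⇒m∸n≡0 (m≤n⇒m≤1+n (≮⇒≥ m≮v))) (sym (m≤n⇒m∸n≡0 (≮⇒≥ m≮v))))

‼-map⁺ : ∀ (f : ℕ → ℕ) xs {i v} → xs ‼ i ≡ just v → map f xs ‼ i ≡ just (f v)
‼-map⁺ f (_ ∷ _) {zero} refl = refl
‼-map⁺ f (_ ∷ xs) {suc i} xs[i] = ‼-map⁺ f xs xs[i]

‼-map⁻ : ∀ (f : ℕ → ℕ) xs {i w} → map f xs ‼ i ≡ just w → ∃[ v ] xs ‼ i ≡ just v × f v ≡ w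
‼-map⁻ f (a ∷ xs) {zero} refl = a , refl , refl
‼-map⁻ f (a ∷ xs) {suc i} fxs[i] = ‼-map⁻ f xs fxs[i]

‼-suc⇒‼ : ∀ xs {i v} → xs ‼ suc i ≡ just v → ∃[ u ] xs ‼ i ≡ just u
‼-suc⇒‼ (a ∷ xs) {zero} _ = a , refl
‼-suc⇒‼ (a ∷ xs) {suc i} xs[1+i] = ‼-suc⇒‼ xs xs[1+i]

‼-++ˡ : ∀ xs ys {i} → i < length xs → (xs ++ ys) ‼ i ≡ xs ‼ i
‼-++ˡ (a ∷ xs) ys {zero} _ = refl
‼-++ˡ (a ∷ xs) ys {suc i} (s≤s i<n) = ‼-++ˡ xs ys i<n

‼-++ʳ : ∀ xs ys i → (xs ++ ys) ‼ (length xs + i) ≡ ys ‼ i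
‼-++ʳ [] ys i = refl
‼-++ʳ (a ∷ xs) ys i = ‼-++ʳ xs ys i

∈⇒‼ : ∀ {v xs} → v ∈ xs → ∃[ i ] i < length xs × xs ‼ i ≡ just v
∈⇒‼ (here refl) = 0 , s≤s z≤n , refl
∈⇒‼ (there v∈xs) with ∈⇒‼ v∈xs
... | i , i<n , xs[i] = suc i , s≤s i<n , xs[i]

‼⇒0<countEq : ∀ xs {i v} → xs ‼ i ≡ just v → 0 < countEq v xs
‼⇒0<countEq (a ∷ xs) {i} {v} xs[i] with a ≟ v | i
... | yes _ | _ = s≤s z≤n
... | no a≢v | zero = ⊥-elim (a≢v (just-injective xs[i]))
... | no _ | suc i = ‼⇒0<countEq xs xs[i]

0<countEq⇒‼ : ∀ xs {v} → 0 < countEq v xs → ∃[ i ] xs ‼ i ≡ just v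
0<countEq⇒‼ (a ∷ xs) {v} pos with a ≟ v
... | yes refl = 0 , refl
... | no _ with 0<countEq⇒‼ xs pos
...   | i , xs[i] = suc i , xs[i]

‼⇒1<countEq-∷ : ∀ xs {k a} → xs ‼ k ≡ just a → 1 < countEq a (a ∷ xs)
‼⇒1<countEq-∷ xs {a = a} xs[k] with a ≟ a
... | yes _ = s≤s (‼⇒0<countEq xs xs[k])
... | no a≢a = ⊥-elim (a≢a refl)

countEq≤1⇒‼-injective : ∀ xs {v i j} → countEq v xs ≤ 1 →
                        xs ‼ i ≡ just v → xs ‼ j ≡ just v → i ≡ j
countEq≤1⇒‼-injective (a ∷ xs) {i = zero} {zero} _ _ _ = refl
countEq≤1⇒‼-injective (a ∷ xs) {i = zero} {suc j} once refl xs[j] =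
  ⊥-elim (<⇒≱ (‼⇒1<countEq-∷ xs xs[j]) once)
countEq≤1⇒‼-injective (a ∷ xs) {i = suc i} {zero} once xs[i] refl =
  ⊥-elim (<⇒≱ (‼⇒1<countEq-∷ xs xs[i]) once)
countEq≤1⇒‼-injective (a ∷ xs) {i = suc i} {suc j} once xs[i] xs[j] =
  cong suc (countEq≤1⇒‼-injective xs (≤-trans (m≤n+m _ _) once) xs[i] xs[j])

module PermutationWord {p : List ℕ} (perm : IsPerm p) where

  private
    n = length p

    countEq-p : ∀ v → countEq v p ≡ countEq v (interval 1 n)
    countEq-p v = trans (countEq-↭ v perm) (cong (countEq v) (map-suc-upTo n))

  ‼-injective : ∀ {i j v} → p ‼ i ≡ just v → p ‼ j ≡ just v → i ≡ j
  ‼-injective {v = v} =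
    countEq≤1⇒‼-injective p (subst (_≤ 1) (sym (countEq-p v)) (countEq-interval-≤1 v 1 n))

  ‼-bounded : ∀ {i v} → p ‼ i ≡ just v → 1 ≤ v × v ≤ n
  ‼-bounded {v = v} p[i]
    with 0<countEq-interval⇒ 1 n (subst (0 <_) (countEq-p v) (‼⇒0<countEq p p[i]))
  ... | 1≤v , v<1+n = 1≤v , ≤-pred v<1+n

  ‼-onto : ∀ {v} → 1 ≤ v → v ≤ n → ∃[ i ] p ‼ i ≡ just v
  ‼-onto {v} 1≤v v≤n =
    0<countEq⇒‼ p (subst (0 <_) (sym (countEq-p v)) (⇒0<countEq-interval 1 n 1≤v (s≤s v≤n)))

  ‼⇒countLess : ∀ {i v} → p ‼ i ≡ just v → suc (countLess v p) ≡ v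
  ‼⇒countLess {v = v} p[i] = begin
    suc (countLess v p)                    ≡⟨ cong suc (countLess-↭ v perm) ⟩
    suc (countLess v (map suc (upTo n)))   ≡⟨ cong (λ q → suc (countLess v q)) (map-suc-upTo n) ⟩
    suc (countLess v (interval 1 n))       ≡⟨ cong suc (countLess-interval 1 n (m≤n⇒m≤1+n v≤n)) ⟩
    suc (v ∸ 1)                            ≡⟨ m+[n∸m]≡n 1≤v ⟩
    v                                      ∎
    where
    open ≡-Reasoning
    1≤v = proj₁ (‼-bounded p[i])
    v≤n = proj₂ (‼-bounded p[i])

ascentTopsAfter : ℕ → List ℕ → List ℕ
ascentTopsAfter prev [] = []
ascentTopsAfter prev (b ∷ r) = if ⌊ prev <? b ⌋ then b ∷ ascentTopsAfter b r else ascentTopsAfter b r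

ascentTops : List ℕ → List ℕ
ascentTops [] = []
ascentTops (a ∷ r) = a ∷ ascentTopsAfter a r

AscentTop⇒‼ : ∀ xs i {v} → AscentTop xs i v → xs ‼ i ≡ just v
AscentTop⇒‼ xs zero xs[0] = xs[0]
AscentTop⇒‼ xs (suc i) (xs[1+i] , _) = xs[1+i]

∈-ascentTopsAfter⁺ : ∀ prev r {j u t} → (prev ∷ r) ‼ j ≡ just u → (prev ∷ r) ‼ suc j ≡ just t →
                     u < t → t ∈ ascentTopsAfter prev r
∈-ascentTopsAfter⁺ prev (b ∷ r) {zero} refl refl prev<b with prev <? b
... | yes _ = here refl
... | no prev≮b = ⊥-elim (prev≮b prev<b)
∈-ascentTopsAfter⁺ prev (b ∷ r) {suc j} r[j] r[1+j] u<t with prev <? b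
... | yes _ = there (∈-ascentTopsAfter⁺ b r r[j] r[1+j] u<t)
... | no _ = ∈-ascentTopsAfter⁺ b r r[j] r[1+j] u<t

∈-ascentTops⁺ : ∀ xs i {t} → AscentTop xs i t → t ∈ ascentTops xs
∈-ascentTops⁺ (a ∷ r) zero refl = here refl
∈-ascentTops⁺ (a ∷ r) (suc i) (xs[1+i] , u , xs[i] , u<t) =
  there (∈-ascentTopsAfter⁺ a r xs[i] xs[1+i] u<t)

∈-ascentTopsAfter⁻ : ∀ prev r {t} → t ∈ ascentTopsAfter prev r →
                     ∃[ j ] Σ ℕ λ u → (prev ∷ r) ‼ j ≡ just u × (prev ∷ r) ‼ suc j ≡ just t × u < t
∈-ascentTopsAfter⁻ prev (b ∷ r) t∈ with prev <? b
∈-ascentTopsAfter⁻ prev (b ∷ r) (here refl) | yes prev<b = 0 , prev , refl , refl , prev<b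
∈-ascentTopsAfter⁻ prev (b ∷ r) (there t∈) | yes _ with ∈-ascentTopsAfter⁻ b r t∈
... | j , u , r[j] , r[1+j] , u<t = suc j , u , r[j] , r[1+j] , u<t
∈-ascentTopsAfter⁻ prev (b ∷ r) t∈ | no _ with ∈-ascentTopsAfter⁻ b r t∈
... | j , u , r[j] , r[1+j] , u<t = suc j , u , r[j] , r[1+j] , u<t

∈-ascentTops⁻ : ∀ xs {t} → t ∈ ascentTops xs → ∃[ i ] AscentTop xs i t
∈-ascentTops⁻ (a ∷ r) (here refl) = 0 , refl
∈-ascentTops⁻ (a ∷ r) (there t∈) with ∈-ascentTopsAfter⁻ a r t∈
... | j , u , xs[j] , xs[1+j] , u<t = suc j , xs[1+j] , u , xs[j] , u<t

module Rank {P : ℕ → Set} (P? : Decidable P) where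

  rank : ℕ → ℕ
  rank zero = zero
  rank (suc v) with P? (suc v)
  ... | yes _ = suc (rank v)
  ... | no _ = rank v

  rank-≤-suc : ∀ v → rank v ≤ rank (suc v)
  rank-≤-suc v with P? (suc v)
  ... | yes _ = n≤1+n (rank v)
  ... | no _ = ≤-refl

  rank-suc-≤ : ∀ v → rank (suc v) ≤ suc (rank v)
  rank-suc-≤ v with P? (suc v)
  ... | yes _ = ≤-refl
  ... | no _ = n≤1+n (rank v)

  rank-∈ : ∀ {v} → P (suc v) → rank (suc v) ≡ suc (rank v)
  rank-∈ {v} Pv with P? (suc v)
  ... | yes _ = refl
  ... | no ¬Pv = ⊥-elim (¬Pv Pv)

  rank-∉ : ∀ {v} → ¬ P (suc v) → rank (suc v) ≡ rank v
  rank-∉ {v} ¬Pv with P? (suc v)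
  ... | yes Pv = ⊥-elim (¬Pv Pv)
  ... | no _ = refl

  rank-mono : ∀ {u v} → u ≤ v → rank u ≤ rank v
  rank-mono {v = zero} z≤n = ≤-refl
  rank-mono {v = suc v} u≤1+v with m≤n⇒m<n∨m≡n u≤1+v
  ... | inj₁ (s≤s u≤v) = ≤-trans (rank-mono u≤v) (rank-≤-suc v)
  ... | inj₂ refl = ≤-refl

  rank-strict : ∀ {u t v} → u < t → t ≤ v → P t → rank u < rank v
  rank-strict {u} {suc t} {v} (s≤s u≤t) t≤v Pt = begin-strict
    rank u        <⟨ s≤s (rank-mono u≤t) ⟩
    suc (rank t)  ≡⟨ rank-∈ Pt ⟨
    rank (suc t)  ≤⟨ rank-mono t≤v ⟩
    rank v        ∎
    where open ≤-Reasoning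

  rank-onto : ∀ m {w} → w ≤ rank m → ∃[ v ] v ≤ m × rank v ≡ w
  rank-onto zero w≤0 = 0 , z≤n , sym (n≤0⇒n≡0 w≤0)
  rank-onto (suc m) {w} w≤rank with w ≤? rank m
  ... | yes w≤rank-m with rank-onto m w≤rank-m
  ...   | v , v≤m , rank-v = v , m≤n⇒m≤1+n v≤m , rank-v
  rank-onto (suc m) {w} w≤rank | no w≰rank-m =
    suc m , ≤-refl , ≤-antisym (≤-trans (rank-suc-≤ m) (≰⇒> w≰rank-m)) w≤rank

-- Ties of map f p are ordered from left to right, as a stable sort would order them.
IsStableCompression : (ℕ → ℕ) → List ℕ → Set
IsStableCompression f p =
  ∀ {i j a b} → i < j → p ‼ i ≡ just a → p ‼ j ≡ just b → a < b ⇔ f a ≤ f b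

st-map : ∀ (f : ℕ → ℕ) {p} → IsPerm p → IsStableCompression f p → st (map f p) ≡ p
st-map f {p} perm stable = stGo-map [] p refl
  where
  open PermutationWord perm using (‼⇒countLess)

  x = map f p

  entry : ∀ pre a post → pre ++ a ∷ post ≡ p →
          suc (countLess (f a) x + countEq (f a) (map f pre)) ≡ a
  entry pre a post eq = trans (cong suc counts) (‼⇒countLess a-at-L)
    where
    L = length pre
    at : ∀ {k v} → (pre ++ a ∷ post) ‼ k ≡ just v → p ‼ k ≡ just v
    at {k} {v} = subst (λ q → q ‼ k ≡ just v) eq
    a-at-L : p ‼ (L + 0) ≡ just a
    a-at-L = at (‼-++ʳ pre (a ∷ post) 0)

    agree-pre : ∀ {b} → b ∈ pre → f b < suc (f a) ⇔ b < a
    agree-pre b∈ with ∈⇒‼ b∈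
    ... | k , k<L , pre[k] = mk⇔ (λ fb<1+fa → from e (≤-pred fb<1+fa)) (λ b<a → s≤s (to e b<a))
      where
      e = stable (subst (_ <_) (sym (+-identityʳ L)) k<L)
                 (at (trans (‼-++ˡ pre (a ∷ post) k<L) pre[k])) a-at-L

    agree-post : ∀ {b} → b ∈ post → f b < f a ⇔ b < a
    agree-post {b} b∈ with ∈⇒‼ b∈
    ... | k , _ , post[k] =
      mk⇔ fb<fa⇒b<a (λ b<a → ≰⇒> (λ fa≤fb → <-asym b<a (from e fa≤fb)))
      where
      e = stable (+-monoʳ-< L (s≤s z≤n)) a-at-L (at (trans (‼-++ʳ pre (a ∷ post) (suc k)) post[k]))
      fb<fa⇒b<a : f b < f a → b < a
      fb<fa⇒b<a fb<fa with <-cmp b a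
      ... | tri< b<a _ _ = b<a
      ... | tri≈ _ refl _ = ⊥-elim (<-irrefl refl fb<fa)
      ... | tri> _ _ a<b = ⊥-elim (<⇒≱ fb<fa (to e a<b))

    A = countLess (f a) (map f pre)
    B = countLess (f a) (map f post)
    C = countEq (f a) (map f pre)

    counts : countLess (f a) x + C ≡ countLess a p
    counts = begin
      countLess (f a) x + C
        ≡⟨ cong (λ q → countLess (f a) q + C) (trans (cong (map f) (sym eq)) (map-++ f pre (a ∷ post))) ⟩
      countLess (f a) (map f pre ++ f a ∷ map f post) + C
        ≡⟨ cong (_+ C) (countLess-++-∷ (f a) (map f pre) (map f post)) ⟩
      A + B + C
        ≡⟨ xy∙z≈xz∙y A B C ⟩
      A + C + B
        ≡⟨ cong (_+ B) (countLess-suc (f a) (map f pre)) ⟨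
      countLess (suc (f a)) (map f pre) + B
        ≡⟨ cong₂ _+_ (countLess-map f pre agree-pre) (countLess-map f post agree-post) ⟩
      countLess a pre + countLess a post
        ≡⟨ countLess-++-∷ a pre post ⟨
      countLess a (pre ++ a ∷ post)
        ≡⟨ cong (countLess a) eq ⟩
      countLess a p
        ∎
      where open ≡-Reasoning

  stGo-map : ∀ pre rest → pre ++ rest ≡ p → stGo x (map f pre) (map f rest) ≡ rest
  stGo-map pre [] _ = refl
  stGo-map pre (a ∷ post) eq = cong₂ _∷_ (entry pre a post eq)
    (trans (cong (λ z → stGo x z (map f post)) (sym (map-++ f pre [ a ])))
           (stGo-map (pre ++ [ a ]) post (trans (++-assoc pre [ a ] post) eq)))

module OmegaWord {p : List ℕ} (p∈Ω : InΩ p) where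

  private
    perm = proj₁ p∈Ω
    avoids = proj₂ (proj₂ p∈Ω)

  open PermutationWord perm

  IsTop : ℕ → Set
  IsTop v = v ∈ ascentTops p

  open Rank (_∈? ascentTops p) public

  1-isTop : ∀ {i v} → p ‼ i ≡ just v → IsTop 1
  1-isTop {i} p[i] with proj₁ (proj₂ p∈Ω)
  ... | inj₂ p[0]≡1 = ∈-ascentTops⁺ p 0 p[0]≡1
  ... | inj₁ refl with p[i]
  ...   | ()

  top-at : ∀ {i a} → p ‼ i ≡ just a → IsTop a → AscentTop p i a
  top-at {i} p[i] a-top with ∈-ascentTops⁻ p a-top
  ... | j , top rewrite ‼-injective p[i] (AscentTop⇒‼ p j top) = top

  nonTop⇒predecessor-before : ∀ {i w} → p ‼ i ≡ just w → ¬ IsTop w →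
                              ∃[ w′ ] w ≡ suc w′ × ∃[ k ] k < i × p ‼ k ≡ just w′
  nonTop⇒predecessor-before {w = zero} p[i] _ with () ← proj₁ (‼-bounded p[i])
  nonTop⇒predecessor-before {w = 1} p[i] ¬top = ⊥-elim (¬top (1-isTop p[i]))
  nonTop⇒predecessor-before {zero} {suc (suc w)} p[0] ¬top = ⊥-elim (¬top (∈-ascentTops⁺ p 0 p[0]))
  nonTop⇒predecessor-before {suc i} {suc (suc w)} p[1+i] ¬top with ‼-suc⇒‼ p p[1+i]
  ... | c , p[i] with <-cmp c (suc (suc w))
  ... | tri< c<w _ _ = ⊥-elim (¬top (∈-ascentTops⁺ p (suc i) (p[1+i] , c , p[i] , c<w)))
  ... | tri≈ _ refl _ = ⊥-elim (1+n≢n (‼-injective p[1+i] p[i]))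
  ... | tri> _ _ w<c
    with ‼-onto {suc w} (s≤s z≤n) (≤-trans (n≤1+n _) (proj₂ (‼-bounded p[1+i])))
  ...   | k , p[k] with <-cmp k (suc i)
  ...     | tri< k<1+i _ _ = suc w , refl , k , k<1+i , p[k]
  ...     | tri≈ _ refl _ = ⊥-elim (1+n≢n (just-injective (trans (sym p[1+i]) p[k])))
  ...     | tri> _ _ 1+i<k =
    ⊥-elim (avoids i k c (suc (suc w)) (suc w) 1+i<k p[i] p[1+i] p[k] (w<c , +-comm 1 (suc w)))

  descent⇒top-between : ∀ {i j w u} → i < j → p ‼ i ≡ just w → p ‼ j ≡ just u → u < w →
                        ∃[ t ] u < t × t ≤ w × IsTop t
  descent⇒top-between {w = suc w} {u} i<j p[i] p[j] u<w with suc w ∈? ascentTops p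
  ... | yes top = suc w , u<w , ≤-refl , top
  ... | no ¬top with nonTop⇒predecessor-before p[i] ¬top
  ...   | _ , refl , k , k<i , p[k] with <-cmp u w
  ...     | tri≈ _ refl _ = ⊥-elim (<-irrefl (‼-injective p[k] p[j]) (<-trans k<i i<j))
  ...     | tri> _ _ w<u = ⊥-elim (<⇒≱ w<u (≤-pred u<w))
  ...     | tri< u<w′ _ _ with descent⇒top-between (<-trans k<i i<j) p[k] p[j] u<w′
  ...       | t , u<t , t≤w , top = t , u<t , m≤n⇒m≤1+n t≤w , top

  rank-stable : IsStableCompression rank p
  rank-stable {a = a} {b} i<j p[i] p[j] = mk⇔ (λ a<b → rank-mono (<⇒≤ a<b)) rank≤⇒<
    where
    rank≤⇒< : rank a ≤ rank b → a < b
    rank≤⇒< rank-a≤b with <-cmp a b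
    ... | tri< a<b _ _ = a<b
    ... | tri≈ _ refl _ = ⊥-elim (<-irrefl (‼-injective p[i] p[j]) i<j)
    ... | tri> _ _ b<a with descent⇒top-between i<j p[i] p[j] b<a
    ...   | t , b<t , t≤a , top = ⊥-elim (<⇒≱ (rank-strict b<t t≤a top) rank-a≤b)

  x : List ℕ
  x = map rank p

  rank-positive : ∀ {i v} → p ‼ i ≡ just v → 1 ≤ rank v
  rank-positive p[i] = rank-strict {0} {1} (s≤s z≤n) (proj₁ (‼-bounded p[i])) (1-isTop p[i])

  x-isCayley : IsCayley x
  x-isCayley = positive , rank (length p) , λ w → mk⇔ (occurs w) (bounded w)
    where
    positive : ∀ i w → x ‼ i ≡ just w → 1 ≤ w
    positive i w x[i] with ‼-map⁻ rank p x[i]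
    ... | v , p[i] , refl = rank-positive p[i]

    occurs : ∀ w → 1 ≤ w × w ≤ rank (length p) → ∃[ i ] x ‼ i ≡ just w
    occurs w (1≤w , w≤max) with rank-onto (length p) w≤max
    ... | zero , _ , refl with () ← 1≤w
    ... | suc v , v≤n , refl with ‼-onto (s≤s z≤n) v≤n
    ...   | i , p[i] = i , ‼-map⁺ rank p p[i]

    bounded : ∀ w → ∃[ i ] x ‼ i ≡ just w → 1 ≤ w × w ≤ rank (length p)
    bounded w (i , x[i]) with ‼-map⁻ rank p x[i]
    ... | v , p[i] , refl = rank-positive p[i] , rank-mono (proj₂ (‼-bounded p[i]))

  ascentTop⇒rank-ascentTop : ∀ {i a} → AscentTop p i a → AscentTop x i (rank a)
  ascentTop⇒rank-ascentTop {zero} p[0] = ‼-map⁺ rank p p[0]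
  ascentTop⇒rank-ascentTop {suc i} top@(p[1+i] , c , p[i] , c<a) =
    ‼-map⁺ rank p p[1+i] , rank c , ‼-map⁺ rank p p[i] ,
    rank-strict c<a ≤-refl (∈-ascentTops⁺ p (suc i) top)

  rank-ascentTop⇒ascentTop : ∀ {i a} → p ‼ i ≡ just a → AscentTop x i (rank a) → AscentTop p i a
  rank-ascentTop⇒ascentTop {zero} p[0] _ = p[0]
  rank-ascentTop⇒ascentTop {suc i} p[1+i] (_ , _ , x[i] , x[i]<rank-a) with ‼-map⁻ rank p x[i]
  ... | c , p[i] , refl = p[1+i] , c , p[i] , from (rank-stable ≤-refl p[i] p[1+i]) (<⇒≤ x[i]<rank-a)

  ascentTop⇒leftmost : ∀ {i a} → AscentTop p i a → LeftmostCopy x i (rank a)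
  ascentTop⇒leftmost {i} {a} top = ‼-map⁺ rank p p[i] , no-earlier
    where
    p[i] = AscentTop⇒‼ p i top
    no-earlier : ∀ k → k < i → ¬ (x ‼ k ≡ just (rank a))
    no-earlier k k<i x[k] with ‼-map⁻ rank p x[k]
    ... | b , p[k] , rank-b≡a = <-irrefl rank-b≡a (rank-strict b<a ≤-refl (∈-ascentTops⁺ p i top))
      where b<a = from (rank-stable k<i p[k] p[i]) (≤-reflexive rank-b≡a)

  leftmost⇒ascentTop : ∀ {i a} → p ‼ i ≡ just a → LeftmostCopy x i (rank a) → AscentTop p i a
  leftmost⇒ascentTop {a = a} p[i] (_ , no-earlier) with a ∈? ascentTops p
  ... | yes top = top-at p[i] top
  ... | no ¬top with nonTop⇒predecessor-before p[i] ¬top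
  ...   | w , refl , k , k<i , p[k] =
    ⊥-elim (no-earlier k k<i (trans (‼-map⁺ rank p p[k]) (cong just (sym (rank-∉ ¬top)))))

  x-ascentTop⇒leftmost : ∀ {i w} → AscentTop x i w → LeftmostCopy x i w
  x-ascentTop⇒leftmost {i} top with ‼-map⁻ rank p (AscentTop⇒‼ x i top)
  ... | a , p[i] , refl = ascentTop⇒leftmost (rank-ascentTop⇒ascentTop p[i] top)

  x-leftmost⇒ascentTop : ∀ {i w} → LeftmostCopy x i w → AscentTop x i w
  x-leftmost⇒ascentTop lm with ‼-map⁻ rank p (proj₁ lm)
  ... | a , p[i] , refl = ascentTop⇒rank-ascentTop (leftmost⇒ascentTop p[i] lm)

  x-isPrimitive : IsPrimitive x
  x-isPrimitive i _ _ x[i] x[1+i] rank-c≡a with ‼-map⁻ rank p x[i] | ‼-map⁻ rank p x[1+i]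
  ... | c , p[i] , refl | a , p[1+i] , refl =
    proj₂ (ascentTop⇒leftmost (p[1+i] , c , p[i] , c<a)) i ≤-refl (trans x[i] (cong just rank-c≡a))
    where c<a = from (rank-stable ≤-refl p[i] p[1+i]) (≤-reflexive rank-c≡a)

proposition3p6 : (p : List ℕ) → InΩ p → Σ (List ℕ) (λ x → IsPrimitiveModAscent x × st x ≡ p)
proposition3p6 p p∈Ω =
  x , ((x-isCayley , λ _ _ → mk⇔ x-ascentTop⇒leftmost x-leftmost⇒ascentTop) , x-isPrimitive)
    , st-map rank (proj₁ p∈Ω) rank-stable
  where open OmegaWord p∈Ω
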